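{- For every $\mathsf{F}$-term $P^{\mathsf{F}}$ and every $\mathsf{T}$-term $P^{\mathsf{T}}$: $\mathrm{EqFSCL} \vdash P^{\mathsf{F}} = P^{\mathsf{F}} \wedge^{\circ} x$ and $\mathrm{EqFSCL} \vdash P^{\mathsf{T}} = P^{\mathsf{T}} \vee^{\circ} x$, where $x$ is a variable.
   Context: Let $A$ be a countable set of atoms; SCL-terms are $P ::= a \ (a\in A) \mid \mathsf{T} \mid \mathsf{F} \mid \neg P \mid (P \wedge^{\circ} P) \mid (P \vee^{\circ} P)$ (short-circuit left-sequential connectives). $\mathsf{T}$-terms: $P^{\mathsf{T}} ::= \mathsf{T} \mid (a \wedge^{\circ} P^{\mathsf{T}}) \vee^{\circ} P^{\mathsf{T}}$; $\mathsf{F}$-terms: $P^{\mathsf{F}} ::= \mathsf{F} \mid (a \vee^{\circ} P^{\mathsf{F}}) \wedge^{\circ} P^{\mathsf{F}}$ ($a\in A$). $\mathrm{EqFSCL}$ is the set of equations: $\mathsf{F} = \neg\mathsf{T}$; $x \vee^{\circ} y = \neg(\neg x \wedge^{\circ} \neg y)$; $\neg\neg x = x$; $(x \wedge^{\circ} y) \wedge^{\circ} z = x \wedge^{\circ} (y \wedge^{\circ} z)$; $\mathsf{T} \wedge^{\circ} x = x$; $x \wedge^{\circ} \mathsf{T} = x$; $\mathsf{F} \wedge^{\circ} x = \mathsf{F}$; $x \wedge^{\circ} \mathsf{F} = \neg x \wedge^{\circ} \mathsf{F}$; $(x \wedge^{\circ} \mathsf{F}) \vee^{\circ} y = (x \vee^{\circ}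 \mathsf{T}) \wedge^{\circ} y$; $(x \wedge^{\circ} y) \vee^{\circ} (z \wedge^{\circ} \mathsf{F}) = (x \vee^{\circ} (z \wedge^{\circ} \mathsf{F})) \wedge^{\circ} (y \vee^{\circ} (z \wedge^{\circ} \mathsf{F}))$. $\mathrm{EqFSCL}\vdash s=t$ denotes derivability by equational logic. -}

module Defs where

open import Data.Nat using (ℕ)

-- SCL-terms over a set of atoms A, extended with variables (indexed by ℕ)
-- so that equations such as  P = P ∧ x  with a variable x can be stated.
data Term (A : Set) : Set where
  var  : ℕ → Term A
  atom : A → Term A
  T    : Term A
  F    : Term A
  ¬_   : Term A → Term A
  _∧ᵒ_ : Term A → Term A → Term A
  _∨ᵒ_ : Term A → Term A → Term A

infix  9 ¬_
infixr 7 _∧ᵒ_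
infixr 6 _∨ᵒ_

data IsTTerm {A : Set} : Term A → Set where
  tT   : IsTTerm T
  tStep : ∀ (a : A) {P Q} → IsTTerm P → IsTTerm Q → IsTTerm ((atom a ∧ᵒ P) ∨ᵒ Q)

data IsFTerm {A : Set} : Term A → Set where
  fF   : IsFTerm F
  fStep : ∀ (a : A) {P Q} → IsFTerm P → IsFTerm Q → IsFTerm ((atom a ∨ᵒ P) ∧ᵒ Q)

subst : ∀ {A} → (ℕ → Term A) → Term A → Term A
subst σ (var n)  = σ n
subst σ (atom a) = atom a
subst σ T        = T
subst σ F        = F
subst σ (¬ p)    = ¬ subst σ p
subst σ (p ∧ᵒ q) = subst σ p ∧ᵒ subst σ q
subst σ (p ∨ᵒ q) = subst σ p ∨ᵒ subst σ q

module _ {A : Set} where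
  private
    x y z : Term A
    x = var 0
    y = var 1
    z = var 2

  data Axiom : Term A → Term A → Set where
    ax1  : Axiom F (¬ T)
    ax2  : Axiom (x ∨ᵒ y) (¬ (¬ x ∧ᵒ ¬ y))
    ax3  : Axiom (¬ ¬ x) x
    ax4  : Axiom ((x ∧ᵒ y) ∧ᵒ z) (x ∧ᵒ (y ∧ᵒ z))
    ax5  : Axiom (T ∧ᵒ x) x
    ax6  : Axiom (x ∧ᵒ T) x
    ax7  : Axiom (F ∧ᵒ x) F
    ax8  : Axiom (x ∧ᵒ F) (¬ x ∧ᵒ F)
    ax9  : Axiom ((x ∧ᵒ F) ∨ᵒ y) ((x ∨ᵒ T) ∧ᵒ y)
    ax10 : Axiom ((x ∧ᵒ y) ∨ᵒ (z ∧ᵒ F))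
                 ((x ∨ᵒ (z ∧ᵒ F)) ∧ᵒ (y ∨ᵒ (z ∧ᵒ F)))

infix 4 EqFSCL⊢_≈_
data EqFSCL⊢_≈_ {A : Set} : Term A → Term A → Set where
  axiom : ∀ {s t} (σ : ℕ → Term A) → Axiom s t → EqFSCL⊢ subst σ s ≈ subst σ t
  refl  : ∀ {s} → EqFSCL⊢ s ≈ s
  sym   : ∀ {s t} → EqFSCL⊢ s ≈ t → EqFSCL⊢ t ≈ s
  trans : ∀ {s t u} → EqFSCL⊢ s ≈ t → EqFSCL⊢ t ≈ u → EqFSCL⊢ s ≈ u
  cong¬ : ∀ {s t} → EqFSCL⊢ s ≈ t → EqFSCL⊢ ¬ s ≈ ¬ t
  cong∧ : ∀ {s t s' t'} → EqFSCL⊢ s ≈ t → EqFSCL⊢ s' ≈ t' → EqFSCL⊢ s ∧ᵒ s' ≈ t ∧ᵒ t'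
  cong∨ : ∀ {s t s' t'} → EqFSCL⊢ s ≈ t → EqFSCL⊢ s' ≈ t' → EqFSCL⊢ s ∨ᵒ s' ≈ t ∨ᵒ t'

module Submission where

-- Both halves are proved by induction on the shape of the F-/T-term, and
-- only the right spine matters:
--   * F ∧ x = F is axiom ax7, and for (a ∨ P) ∧ Q associativity of ∧ (ax4)
--     reduces the claim to the one for Q;
--   * T ∨ x = T and associativity of ∨ are not axioms, but follow from
--     their ∧-counterparts (ax7, ax4) by the De Morgan definition of ∨
--     (ax2), double negation (ax3) and F = ¬T (ax1).

open import Defs
open import Data.Nat using (ℕ; zero; suc)
open import Data.Product using (_×_; _,_)
open import Relation.Binary.Bundles using (Setoid)
import Relation.Binary.Reasoning.Setoid as SetoidReasoning

module _ {A : Set} where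

  EqFSCL-setoid : Setoid _ _
  EqFSCL-setoid = record
    { Carrier       = Term A
    ; _≈_           = EqFSCL⊢_≈_
    ; isEquivalence = record { refl = refl ; sym = sym ; trans = trans }
    }

  open SetoidReasoning EqFSCL-setoid

  [_,_,_] : Term A → Term A → Term A → ℕ → Term A
  [ u , v , w ] zero          = u
  [ u , v , w ] (suc zero)    = v
  [ u , v , w ] (suc (suc _)) = w

  F≈¬T : EqFSCL⊢ F ≈ ¬ T
  F≈¬T = axiom [ T , T , T ] ax1

  ∨-deMorgan : (u v : Term A) → EqFSCL⊢ u ∨ᵒ v ≈ ¬ (¬ u ∧ᵒ ¬ v)
  ∨-deMorgan u v = axiom [ u , v , T ] ax2

  ¬¬-elim : (u : Term A) → EqFSCL⊢ ¬ ¬ u ≈ u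
  ¬¬-elim u = axiom [ u , T , T ] ax3

  ∧-assoc : (u v w : Term A) → EqFSCL⊢ (u ∧ᵒ v) ∧ᵒ w ≈ u ∧ᵒ (v ∧ᵒ w)
  ∧-assoc u v w = axiom [ u , v , w ] ax4

  F∧-zero : (u : Term A) → EqFSCL⊢ F ∧ᵒ u ≈ F
  F∧-zero u = axiom [ u , T , T ] ax7

  ¬∨≈∧¬ : (u v : Term A) → EqFSCL⊢ ¬ (u ∨ᵒ v) ≈ ¬ u ∧ᵒ ¬ v
  ¬∨≈∧¬ u v = trans (cong¬ (∨-deMorgan u v)) (¬¬-elim (¬ u ∧ᵒ ¬ v))

  ∨-assoc : (u v w : Term A) → EqFSCL⊢ (u ∨ᵒ v) ∨ᵒ w ≈ u ∨ᵒ (v ∨ᵒ w)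
  ∨-assoc u v w = begin
    (u ∨ᵒ v) ∨ᵒ w             ≈⟨ ∨-deMorgan (u ∨ᵒ v) w ⟩
    ¬ (¬ (u ∨ᵒ v) ∧ᵒ ¬ w)     ≈⟨ cong¬ (cong∧ (¬∨≈∧¬ u v) refl) ⟩
    ¬ ((¬ u ∧ᵒ ¬ v) ∧ᵒ ¬ w)   ≈⟨ cong¬ (∧-assoc (¬ u) (¬ v) (¬ w)) ⟩
    ¬ (¬ u ∧ᵒ (¬ v ∧ᵒ ¬ w))   ≈⟨ cong¬ (cong∧ refl (sym (¬∨≈∧¬ v w))) ⟩
    ¬ (¬ u ∧ᵒ ¬ (v ∨ᵒ w))     ≈⟨ sym (∨-deMorgan u (v ∨ᵒ w)) ⟩
    u ∨ᵒ (v ∨ᵒ w)             ∎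

  T∨-zero : (u : Term A) → EqFSCL⊢ T ∨ᵒ u ≈ T
  T∨-zero u = begin
    T ∨ᵒ u             ≈⟨ ∨-deMorgan T u ⟩
    ¬ (¬ T ∧ᵒ ¬ u)     ≈⟨ cong¬ (cong∧ (sym F≈¬T) refl) ⟩
    ¬ (F ∧ᵒ ¬ u)       ≈⟨ cong¬ (F∧-zero (¬ u)) ⟩
    ¬ F                ≈⟨ cong¬ F≈¬T ⟩
    ¬ ¬ T              ≈⟨ ¬¬-elim T ⟩
    T                  ∎

  -- Every F-term absorbs any right ∧-operand: it always evaluates to F
  -- before x is reached.
  FTerm-∧-absorb : (x : Term A) → ∀ {P} → IsFTerm P → EqFSCL⊢ P ∧ᵒ x ≈ P
  FTerm-∧-absorb x fF = F∧-zero x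
  FTerm-∧-absorb x (fStep a {P} {Q} _ isQ) = begin
    ((atom a ∨ᵒ P) ∧ᵒ Q) ∧ᵒ x   ≈⟨ ∧-assoc (atom a ∨ᵒ P) Q x ⟩
    (atom a ∨ᵒ P) ∧ᵒ (Q ∧ᵒ x)   ≈⟨ cong∧ refl (FTerm-∧-absorb x isQ) ⟩
    (atom a ∨ᵒ P) ∧ᵒ Q          ∎

  -- Every T-term absorbs any right ∨-operand: it always evaluates to T
  -- before x is reached.
  TTerm-∨-absorb : (x : Term A) → ∀ {P} → IsTTerm P → EqFSCL⊢ P ∨ᵒ x ≈ P
  TTerm-∨-absorb x tT = T∨-zero x
  TTerm-∨-absorb x (tStep a {P} {Q} _ isQ) = begin
    ((atom a ∧ᵒ P) ∨ᵒ Q) ∨ᵒ x   ≈⟨ ∨-assoc (atom a ∧ᵒ P) Q x ⟩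
    (atom a ∧ᵒ P) ∨ᵒ (Q ∨ᵒ x)   ≈⟨ cong∨ refl (TTerm-∨-absorb x isQ) ⟩
    (atom a ∧ᵒ P) ∨ᵒ Q          ∎

mainTheorem18 : {A : Set} → (n : ℕ) →
    (∀ (P : Term A) → IsFTerm P → EqFSCL⊢ P ≈ P ∧ᵒ var n)
    × (∀ (P : Term A) → IsTTerm P → EqFSCL⊢ P ≈ P ∨ᵒ var n)
mainTheorem18 n =
    (λ P isF → sym (FTerm-∧-absorb (var n) isF))
  , (λ P isT → sym (TTerm-∨-absorb (var n) isT))
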